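{- Let $\mathcal{A}$ be a trim, finitely ambiguous (Boolean) finite automaton and let $\mathcal{S}$ be its Schützenberger covering. Then no competing transition of $\mathcal{S}$ belongs to a circuit of $\mathcal{S}$. Consequently, every path of $\mathcal{S}$ contains at most one transition from each competing set.
   Context: A (Boolean) automaton $\mathcal{A}$ with state set $Q$ over $\Sigma$ is given by a set of initial states $\alpha\subseteq Q$, transition relations $\mu(a)\subseteq Q\times Q$ ($a\in\Sigma$), and final states $\beta\subseteq Q$; it is trim if every state lies on a successful path (from an initial to a final state), and finitely ambiguous if there is $k$ with every word labelling at most $k$ successful paths. Determinized automaton $\mathcal{D}$: its states are the subsets of $Q$ reachable from $\alpha$ by $X\mapsto X\cdot a=\{q:\exists p\in X,(p,q)\in\mu(a)\}$; initial state $\alpha$; transition $P\xrightarrow{a}P\cdot a$; $P$ final iff $P\cap\beta\neq\emptyset$. The Schützenberger covering $\mathcal{S}$ of $\mathcal{A}$ is the trim part of the product $\mathcal{A}\odot\mathcal{D}$ (states $(p,P)$, transition $(p,P)\xrightarrow{a}(q,Q')$ iff $p\xrightarrow{a}q$ in $\mathcal{A}$ and $P\xrightarrow{a}Q'$ in $\mathcal{D}$, initial/final iff both components are); its states are exactly the pairs $(p,P)$ with $P$ a state of $\mathcal{D}$ and $p\in P$, and for fixed $P$ the set $\{(p,P):p\in P\}$ is called a column. Distinct transitions of $\mathcal{S}$ having the same label, the same destination, and origins in the same column are called competing; distinct final states in the same column are also competing. A competing set is a maximal set of pairwise competing transitions or of pairwise competing final states. -}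

module Defs where

open import Data.Nat using (ℕ; _≤_)
open import Data.Bool using (Bool; true; false; T; _∧_)
open import Data.Fin using (Fin)
open import Data.Fin.Subset using (Subset)
open import Data.Vec using (lookup; tabulate)
open import Data.List using (List; []; _∷_; length; map; allFin)
open import Data.Bool.ListAction using (or)
open import Data.List.Membership.Propositional using (_∈_)
open import Data.List.Relation.Unary.Unique.Propositional using (Unique)
open import Data.Product using (Σ; ∃; _×_; _,_)
open import Relation.Binary.PropositionalEquality using (_≡_; _≢_)

record Automaton (n m : ℕ) : Set where
  field
    α : Subset n
    μ : Fin m → Fin n → Fin n → Bool   -- μ a p q = true  iff  (p , q) ∈ μ(a)
    β : Subset n

Word : ℕ → Set
Word m = List (Fin m)

module _ {n m : ℕ} (A : Automaton n m) where
  open Automaton A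

  data Path : Fin n → Word m → Fin n → Set where
    []  : ∀ {p} → Path p [] p
    _∷_ : ∀ {p a q w r} → T (μ a p q) → Path q w r → Path p (a ∷ w) r

  SuccPath : Word m → Set
  SuccPath w = Σ (Fin n) λ i → Σ (Fin n) λ f →
               T (lookup α i) × T (lookup β f) × Path i w f

  Trim : Set
  Trim = ∀ q → ∃ λ i → ∃ λ f → ∃ λ u → ∃ λ v →
         T (lookup α i) × T (lookup β f) × Path i u q × Path q v f

  FinitelyAmbiguous : Set
  FinitelyAmbiguous = ∃ λ (k : ℕ) → ∀ (w : Word m) (ps : List (SuccPath w)) →
                      Unique ps → length ps ≤ k

  -- Determinized automaton D (states: subsets reachable from α)

  step : Subset n → Fin m → Subset n
  step X a = tabulate λ q → or (map (λ p → lookup X p ∧ μ a p q) (allFin n))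

  -- Product A ⊙ D.  Its accessible states (p , P) automatically have P
  -- a state of D, since initial product states have P = α.

  PState : Set
  PState = Fin n × Subset n

  PEdge : PState → Fin m → PState → Set
  PEdge (p , P) a (q , Q) = T (μ a p q) × Q ≡ step P a

  PInit : PState → Set
  PInit (p , P) = T (lookup α p) × P ≡ α

  DFinal : Subset n → Set
  DFinal P = ∃ λ q → T (lookup P q) × T (lookup β q)

  PFinal : PState → Set
  PFinal (p , P) = T (lookup β p) × DFinal P

  data PPath : PState → Word m → PState → Set where
    []  : ∀ {s} → PPath s [] s
    _∷_ : ∀ {s a s' w s''} → PEdge s a s' → PPath s' w s'' → PPath s (a ∷ w) s''

  -- Schützenberger covering S = trim part of A ⊙ D

  InS : PState → Set
  InS s = ∃ λ s₀ → ∃ λ u → ∃ λ s₁ → ∃ λ v →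
          PInit s₀ × PPath s₀ u s × PPath s v s₁ × PFinal s₁

  SFinal : PState → Set
  SFinal s = InS s × PFinal s

  Trans : Set
  Trans = PState × Fin m × PState

  origin : Trans → PState
  origin (s , _ , _) = s

  label : Trans → Fin m
  label (_ , a , _) = a

  dest : Trans → PState
  dest (_ , _ , s') = s'

  column : PState → Subset n
  column (_ , P) = P

  IsSTrans : Trans → Set
  IsSTrans (s , a , s') = InS s × InS s' × PEdge s a s'

  data SPath : PState → List Trans → PState → Set where
    []  : ∀ {s} → SPath s [] s
    _∷_ : ∀ {s a s' ts s''} → IsSTrans (s , a , s') → SPath s' ts s'' →
          SPath s ((s , a , s') ∷ ts) s''

  OnCircuit : Trans → Set
  OnCircuit t = ∃ λ s → ∃ λ ts → SPath s ts s × ts ≢ [] × t ∈ ts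

  Competing : Trans → Trans → Set
  Competing t t' = IsSTrans t × IsSTrans t' × t ≢ t' ×
                   label t ≡ label t' × dest t ≡ dest t' ×
                   column (origin t) ≡ column (origin t')

  CompetingTrans : Trans → Set
  CompetingTrans t = ∃ λ t' → Competing t t'

  CompetingFinal : PState → PState → Set
  CompetingFinal s s' = SFinal s × SFinal s' × s ≢ s' × column s ≡ column s'

  PairwiseCompeting : (Trans → Set) → Set
  PairwiseCompeting C = (∀ t → C t → IsSTrans t) ×
                        (∀ t t' → C t → C t' → t ≢ t' → Competing t t')

  CompetingTransSet : (Trans → Set) → Set
  CompetingTransSet C = PairwiseCompeting C ×
    (∀ t → IsSTrans t → (∀ t' → C t' → t ≢ t' → Competing t t') → C t)

-- If a competing transition (p , P) --a--> (q , Q) of S, with competitor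
-- (p' , P) --a--> (q , Q), lay on a circuit labelled w = a v, then P · w = P and
-- A has paths p --w--> p and p' --w--> p.  Choose u with α · u = P.  Since
-- p' ∈ α · u wⁱ for every i, the word u wˡ labels l runs ending in p: the i-th one
-- reaches p' after u wⁱ, enters p and then loops, so the runs differ in the last
-- boundary between copies of w at which they are outside p.  Continued to a final state by co-accessibility of p,
-- they are l distinct successful paths of one word, for every l.
-- Two distinct transitions of a competing set share their destination, so on a
-- path containing both, the segment between them closes a circuit through one of them.
module Submission where

open import Defs
open import Data.Product using (_×_)
open import Data.List using (List)
open import Data.List.Membership.Propositional using (_∈_)
open import Relation.Nullary using (¬_)
open import Relation.Binary.PropositionalEquality using (_≡_)

open import Data.Nat using (ℕ; zero; suc; _≤_)
open import Data.Nat.Properties using (1+n≰n)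
open import Data.Bool using (T)
open import Data.Bool.Properties using (T-∧) renaming (_≟_ to _≟ᴮ_)
open import Data.Fin using (Fin) renaming (_≟_ to _≟ᶠ_)
open import Data.Fin.Subset using (Subset)
open import Data.Vec using (lookup)
open import Data.Vec.Properties using (lookup∘tabulate) renaming (≡-dec to ≡-decᵛ)
open import Data.List using ([]; _∷_; _++_; map; length; allFin)
open import Data.List.Properties
  using (∷-injectiveˡ; ∷-injectiveʳ; ++-cancelʳ; ++-conicalʳ; length-map; map-∘; map-cong)
open import Data.List.Relation.Unary.Any using (here; there; satisfied)
open import Data.List.Relation.Unary.All as All using ()
open import Data.List.Relation.Unary.All.Properties as All using ()
open import Data.List.Relation.Unary.Any.Properties using (any⁺; any⁻)
open import Data.List.Relation.Unary.Unique.Propositional using (Unique; []; _∷_)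
open import Data.List.Relation.Unary.Unique.Propositional.Properties as Unique using ()
open import Data.List.Membership.Propositional using (lose)
open import Data.List.Membership.Propositional.Properties using (∈-allFin; ∈-++⁻; ∈-++⁺ʳ)
open import Data.Product using (∃; ∃₂; _,_; map₂)
open import Data.Product.Properties using () renaming (≡-dec to ≡-decᵖ)
open import Data.Sum using (_⊎_; inj₁; inj₂)
open import Data.Empty using (⊥-elim)
open import Function using (Equivalence; _∘_)
open import Relation.Nullary using (Dec; yes; no)
open import Relation.Binary.PropositionalEquality
  using (_≢_; refl; sym; trans; cong; subst; ≢-sym; module ≡-Reasoning)

Unique-map-++ʳ : ∀ {X Y Z : Set} {kX : X → List Z} {kY : Y → List Z} {f : X → Y} (L : List Z) →
                 (∀ x → kY (f x) ≡ kX x ++ L) →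
                 ∀ {xs} → Unique (map kX xs) → Unique (map kY (map f xs))
Unique-map-++ʳ {kX = kX} {kY} {f} L kY∘f≡ {xs} u =
  subst Unique map-++≡ (Unique.map⁺ (λ {ys} {zs} → ++-cancelʳ L ys zs) u)
  where
  open ≡-Reasoning
  map-++≡ : map (_++ L) (map kX xs) ≡ map kY (map f xs)
  map-++≡ = begin
    map (_++ L) (map kX xs)  ≡⟨ map-∘ xs ⟨
    map ((_++ L) ∘ kX) xs    ≡⟨ map-cong (sym ∘ kY∘f≡) xs ⟩
    map (kY ∘ f) xs          ≡⟨ map-∘ xs ⟩
    map kY (map f xs)        ∎

module _ {n m : ℕ} (A : Automaton n m) where
  open Automaton A

  steps : Subset n → Word m → Subset n
  steps X []      = X
  steps X (a ∷ w) = steps (step A X a) w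

  steps-++ : ∀ X u v → steps X (u ++ v) ≡ steps (steps X u) v
  steps-++ X []      v = refl
  steps-++ X (a ∷ u) v = steps-++ (step A X a) u v

  step⁺ : ∀ X {a p q} → T (lookup X p) → T (μ a p q) → T (lookup (step A X a) q)
  step⁺ X {p = p} {q} p∈X p→q = subst T (sym (lookup∘tabulate _ q))
    (any⁺ _ (lose (∈-allFin p) (Equivalence.from T-∧ (p∈X , p→q))))

  step⁻ : ∀ X {a q} → T (lookup (step A X a) q) → ∃ λ p → T (lookup X p) × T (μ a p q)
  step⁻ X {q = q} q∈ =
    map₂ (Equivalence.to T-∧) (satisfied (any⁻ _ (allFin n) (subst T (lookup∘tabulate _ q) q∈)))

  steps⁺ : ∀ X {p w q} → T (lookup X p) → Path A p w q → T (lookup (steps X w) q)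
  steps⁺ X p∈X []                = p∈X
  steps⁺ X p∈X (_∷_ {a = a} e π) = steps⁺ (step A X a) (step⁺ X p∈X e) π

  steps⁻ : ∀ X w {q} → T (lookup (steps X w) q) → ∃ λ p → T (lookup X p) × Path A p w q
  steps⁻ X []      q∈ = _ , q∈ , []
  steps⁻ X (a ∷ w) q∈ with steps⁻ (step A X a) w q∈
  ... | r , r∈ , π with step⁻ X r∈
  ...   | p , p∈ , e = p , p∈ , e ∷ π

  _++ᴾ_ : ∀ {p u q v r} → Path A p u q → Path A q v r → Path A p (u ++ v) r
  []      ++ᴾ σ = σ
  (e ∷ π) ++ᴾ σ = e ∷ (π ++ᴾ σ)

  after : ∀ {p w q} → Path A p w q → List (Fin n)
  after []                  = []
  after (_∷_ {q = q} _ π) = q ∷ after π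

  states : ∀ {p w q} → Path A p w q → List (Fin n)
  states {p} π = p ∷ after π

  states-++ : ∀ {p u q v r} (π : Path A p u q) (σ : Path A q v r) →
              states (π ++ᴾ σ) ≡ states π ++ after σ
  states-++ []      σ = refl
  states-++ {p} (e ∷ π) σ = cong (p ∷_) (states-++ π σ)

  -- Paths with the same label visit equally many states.
  states-++⇒end-≡ : ∀ {r r' w q q'} (π : Path A r w q) (π' : Path A r' w q') {X Y} →
                    states π ++ X ≡ states π' ++ Y → q ≡ q'
  states-++⇒end-≡ []      []        eq = ∷-injectiveˡ eq
  states-++⇒end-≡ (_ ∷ π) (_ ∷ π') eq = states-++⇒end-≡ π π' (∷-injectiveʳ eq)

  Run : Fin n → Word m → Set
  Run q w = ∃ λ i → T (lookup α i) × Path A i w q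

  runStates : ∀ {q w} → Run q w → List (Fin n)
  runStates (_ , _ , π) = states π

  _▸_ : ∀ {q u r v} → Run q u → Path A q v r → Run r (u ++ v)
  (i , i∈α , π) ▸ σ = i , i∈α , π ++ᴾ σ

  accept : ∀ {q w z f} → T (lookup β f) → Path A q z f → Run q w → SuccPath A (w ++ z)
  accept f∈β σ (i , i∈α , π) = i , _ , i∈α , f∈β , π ++ᴾ σ

  succStates : ∀ {w} → SuccPath A w → List (Fin n)
  succStates (_ , _ , _ , _ , π) = states π

  pumped : Word m → Word m → ℕ → Word m
  pumped u w zero    = u
  pumped u w (suc l) = pumped u w l ++ w

  steps-pumped : ∀ {X u w} → steps (steps X u) w ≡ steps X u →
                 ∀ l → steps X (pumped u w l) ≡ steps X u
  steps-pumped             fix zero    = refl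
  steps-pumped {X} {u} {w} fix (suc l) = begin
    steps X (pumped u w l ++ w)      ≡⟨ steps-++ X (pumped u w l) w ⟩
    steps (steps X (pumped u w l)) w ≡⟨ cong (λ Y → steps Y w) (steps-pumped fix l) ⟩
    steps (steps X u) w              ≡⟨ fix ⟩
    steps X u                        ∎
    where open ≡-Reasoning

  module Pumping {p p' : Fin n} {u w : Word m} (p≢p' : p ≢ p')
                 (p'∈ : T (lookup (steps α u) p')) (fix : steps (steps α u) w ≡ steps α u)
                 (loop : Path A p w p) (enter : Path A p' w p) where

    run-p' : ∀ l → Run p' (pumped u w l)
    run-p' l = steps⁻ α (pumped u w l) (subst (λ Y → T (lookup Y p')) (sym (steps-pumped fix l)) p'∈)

    runs : ∀ l → List (Run p (pumped u w l))
    runs zero    = []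
    runs (suc l) = run-p' l ▸ enter ∷ map (_▸ loop) (runs l)

    length-runs : ∀ l → length (runs l) ≡ l
    length-runs zero    = refl
    length-runs (suc l) = cong suc (trans (length-map (_▸ loop) (runs l)) (length-runs l))

    entering≢looping : ∀ l (ρ : Run p (pumped u w l)) →
                       runStates (run-p' l ▸ enter) ≢ runStates (ρ ▸ loop)
    entering≢looping l (_ , _ , π) eq with run-p' l
    ... | _ , _ , π' = p≢p' (sym (states-++⇒end-≡ π' π
      (trans (sym (states-++ π' enter)) (trans eq (states-++ π loop)))))

    runs-unique : ∀ l → Unique (map runStates (runs l))
    runs-unique zero    = []
    runs-unique (suc l) =
      All.map⁺ (All.map⁺ (All.tabulate λ {ρ} _ → entering≢looping l ρ))
      ∷ Unique-map-++ʳ (after loop) (λ { (_ , _ , π) → states-++ π loop }) (runs-unique l)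

  pumping⇒¬FinitelyAmbiguous :
    ∀ {p p' u w z f} → p ≢ p' → T (lookup (steps α u) p') → steps (steps α u) w ≡ steps α u →
    Path A p w p → Path A p' w p → T (lookup β f) → Path A p z f → ¬ FinitelyAmbiguous A
  pumping⇒¬FinitelyAmbiguous {u = u} {w} {z} p≢p' p'∈ fix loop enter f∈β tail (k , bounded) =
    1+n≰n (subst (_≤ k) length-paths (bounded (pumped u w (suc k) ++ z) paths paths-unique))
    where
    open Pumping {u = u} p≢p' p'∈ fix loop enter
    paths : List (SuccPath A (pumped u w (suc k) ++ z))
    paths = map (accept f∈β tail) (runs (suc k))
    length-paths : length paths ≡ suc k
    length-paths = trans (length-map _ (runs (suc k))) (length-runs (suc k))
    paths-unique : Unique paths
    paths-unique = Unique.map⁻ (Unique-map-++ʳ {kY = succStates} (after tail)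
      (λ { (_ , _ , π) → states-++ π tail }) {runs (suc k)} (runs-unique (suc k)))

  PPath⇒Path : ∀ {x X w y Y} → PPath A (x , X) w (y , Y) → Path A x w y × Y ≡ steps X w
  PPath⇒Path []                               = [] , refl
  PPath⇒Path (_∷_ {s' = _ , _} (e , refl) π) with PPath⇒Path π
  ... | π' , Y≡ = e ∷ π' , Y≡

  SPath⇒PPath : ∀ {s ts s'} → SPath A s ts s' → PPath A s (map (label A) ts) s'
  SPath⇒PPath []                = []
  SPath⇒PPath ((_ , _ , e) ∷ π) = e ∷ SPath⇒PPath π

  InS⇒reachable : ∀ {p P} → InS A (p , P) → ∃ λ u → steps α u ≡ P × T (lookup P p)
  InS⇒reachable ((_ , _) , u , _ , _ , (i∈α , refl) , ι , _) with PPath⇒Path ι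
  ... | π , refl = u , refl , steps⁺ α i∈α π

  InS⇒coaccessible : ∀ {p P} → InS A (p , P) → ∃₂ λ z f → T (lookup β f) × Path A p z f
  InS⇒coaccessible (_ , _ , (_ , _) , z , _ , _ , κ , (f∈β , _)) with PPath⇒Path κ
  ... | π , _ = z , _ , f∈β , π

  _++ˢ_ : ∀ {s xs s' ys s''} → SPath A s xs s' → SPath A s' ys s'' → SPath A s (xs ++ ys) s''
  []      ++ˢ σ = σ
  (e ∷ π) ++ˢ σ = e ∷ (π ++ˢ σ)

  SPath-split : ∀ {s ts s'' t} → SPath A s ts s'' → t ∈ ts →
                ∃₂ λ xs ys → SPath A s xs (origin A t) × SPath A (dest A t) ys s'' × ts ≡ xs ++ t ∷ ys
  SPath-split (_ ∷ π) (here refl) = [] , _ , [] , π , refl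
  SPath-split (e ∷ π) (there t∈) with SPath-split π t∈
  ... | xs , ys , π₁ , π₂ , refl = _ ∷ xs , ys , e ∷ π₁ , π₂ , refl

  SPath-order : ∀ {s ts s' t t'} → SPath A s ts s' → t ∈ ts → t' ∈ ts → t ≢ t' →
                (∃ λ ys → SPath A (dest A t) ys (origin A t')) ⊎ (∃ λ ys → SPath A (dest A t') ys (origin A t))
  SPath-order π t∈ t'∈ t≢t' with SPath-split π t∈
  ... | xs , _ , π₁ , π₂ , refl with ∈-++⁻ xs t'∈
  ...   | inj₁ t'∈xs =
          let (_ , ys , _ , σ , _) = SPath-split π₁ t'∈xs in inj₂ (ys , σ)
  ...   | inj₂ (here refl)    = ⊥-elim (t≢t' refl)
  ...   | inj₂ (there t'∈ys) =
          let (xs' , _ , σ , _ , _) = SPath-split π₂ t'∈ys in inj₁ (xs' , σ)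

  circuit-closing : ∀ {t ys} → IsSTrans A t → SPath A (dest A t) ys (origin A t) → OnCircuit A t
  circuit-closing {t@(o , _ , d)} {ys} e π =
    d , ys ++ t ∷ [] , π ++ˢ last , (λ eq → ∷≢[] (++-conicalʳ ys _ eq)) , ∈-++⁺ʳ ys (here refl)
    where
    last : SPath A o (t ∷ []) d
    last = e ∷ []
    ∷≢[] : t ∷ [] ≢ []
    ∷≢[] ()

  competing∉circuit : FinitelyAmbiguous A → ∀ t → CompetingTrans A t → ¬ OnCircuit A t
  competing∉circuit fa ((p , P) , a , (q , Q))
    (((p' , _) , _ , _) , (inS-p , _ , (p→q , Q≡)) , (inS-p' , _ , (p'→q , _)) , t≢t' , refl , refl , refl)
    (_ , _ , cycle , _ , t∈)
    with SPath-split cycle t∈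
  ... | xs , ys , s⇝p , q⇝s , _
    with PPath⇒Path (SPath⇒PPath (q⇝s ++ˢ s⇝p)) | InS⇒reachable inS-p' | InS⇒coaccessible inS-p
  ... | q→p , P≡ | u , αu≡P , p'∈P | z , f , f∈β , p→f =
    pumping⇒¬FinitelyAmbiguous {u = u} p≢p' p'∈αu fix (p→q ∷ q→p) (p'→q ∷ q→p) f∈β p→f fa
    where
    p≢p' : p ≢ p'
    p≢p' p≡p' = t≢t' (cong (λ x → (x , P) , a , (q , Q)) p≡p')
    p'∈αu : T (lookup (steps α u) p')
    p'∈αu = subst (λ Y → T (lookup Y p')) (sym αu≡P) p'∈P
    v : Word m
    v = map (label A) (ys ++ xs)
    fix : steps (steps α u) (a ∷ v) ≡ steps α u
    fix = subst (λ Y → steps Y (a ∷ v) ≡ Y) (sym αu≡P) (sym (trans P≡ (cong (λ Y → steps Y v) Q≡)))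

  _≟ᵀ_ : (t t' : Trans A) → Dec (t ≡ t')
  _≟ᵀ_ = ≡-decᵖ _≟ˢ_ (≡-decᵖ _≟ᶠ_ _≟ˢ_)
    where
    _≟ˢ_ : (s s' : PState A) → Dec (s ≡ s')
    _≟ˢ_ = ≡-decᵖ _≟ᶠ_ (≡-decᵛ _≟ᴮ_)

  competing-set-on-path-unique : FinitelyAmbiguous A → ∀ C → PairwiseCompeting A C →
    ∀ {s ts s'} → SPath A s ts s' → ∀ {t t'} → t ∈ ts → t' ∈ ts → C t → C t' → t ≡ t'
  competing-set-on-path-unique fa C (_ , pairwise) π {t} {t'} t∈ t'∈ Ct Ct' with t ≟ᵀ t'
  ... | yes t≡t' = t≡t'
  ... | no t≢t' with pairwise t t' Ct Ct' t≢t' | pairwise t' t Ct' Ct (≢-sym t≢t')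
  ...   | c@(e , e' , _ , _ , d≡d' , _) | c' with SPath-order π t∈ t'∈ t≢t'
  ...     | inj₁ (_ , σ) =
            ⊥-elim (competing∉circuit fa t' (t , c') (circuit-closing e' (subst (λ d → SPath A d _ _) d≡d' σ)))
  ...     | inj₂ (_ , σ) =
            ⊥-elim (competing∉circuit fa t (t' , c) (circuit-closing e (subst (λ d → SPath A d _ _) (sym d≡d') σ)))

proposition7 : ∀ {n m} (A : Automaton n m) → Trim A → FinitelyAmbiguous A →
    (∀ t → CompetingTrans A t → ¬ OnCircuit A t)
    × (∀ (C : Trans A → Set) → CompetingTransSet A C →
         ∀ s ts s' → SPath A s ts s' →
         ∀ t t' → t ∈ ts → t' ∈ ts → C t → C t' → t ≡ t')
proposition7 A _ fa =
  competing∉circuit A fa ,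
  λ C (pairwise , _) _ _ _ π _ _ t∈ t'∈ → competing-set-on-path-unique A fa C pairwise π t∈ t'∈
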